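{- Let $G$ and $H$ be graphs, each of order at least two. Then the modular product $G\diamond H$ has no two distinct false twins, i.e., there are no distinct vertices $x,y$ of $G\diamond H$ with $N_{G\diamond H}(x)=N_{G\diamond H}(y)$.
   Context: All graphs are finite, simple and undirected. The modular product $G\diamond H$ has vertex set $V(G)\times V(H)$, and $(g,h)$, $(g',h')$ are adjacent if $g=g'$ and $hh'\in E(H)$, or $gg'\in E(G)$ and $h=h'$, or $gg'\in E(G)$ and $hh'\in E(H)$, or ($g\neq g'$, $h\neq h'$, $gg'\notin E(G)$ and $hh'\notin E(H)$). $N_X(v)$ denotes the open neighborhood of $v$ in $X$. -}

module Defs where

open import Data.Nat using (ℕ; _≤_)
open import Data.Fin using (Fin)
open import Data.Product using (_×_; _,_)
open import Data.Sum using (_⊎_)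
open import Relation.Nullary using (¬_; Dec)
open import Relation.Binary.PropositionalEquality using (_≡_)
open import Function.Bundles using (_⇔_)
open import Level using (0ℓ)

record Graph : Set₁ where
  field
    order : ℕ
    Adj   : Fin order → Fin order → Set
    sym   : ∀ {u v} → Adj u v → Adj v u
    irrefl : ∀ {u} → ¬ Adj u u
    adj?   : ∀ u v → Dec (Adj u v)

open Graph public

V : Graph → Set
V G = Fin (order G)

ModAdj : (G H : Graph) → V G × V H → V G × V H → Set
ModAdj G H (g , h) (g′ , h′) =
    (g ≡ g′ × Adj H h h′)
  ⊎ (Adj G g g′ × h ≡ h′)
  ⊎ (Adj G g g′ × Adj H h h′)
  ⊎ (¬ g ≡ g′ × ¬ h ≡ h′ × ¬ Adj G g g′ × ¬ Adj H h h′)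

SameNeighbourhood : (G H : Graph) → V G × V H → V G × V H → Set
SameNeighbourhood G H x y = ∀ z → ModAdj G H x z ⇔ ModAdj G H y z

{-# OPTIONS --safe #-}

-- Twins x and y are non-adjacent, since x ~ y would give y ~ y.  If both
-- coordinates differ, a common neighbour in the same row or column shows
-- that g g′ ∈ E(G) iff h h′ ∈ E(H), so x and y would be adjacent after all.
-- If x = (g , h) and y = (g , h′) share a coordinate, a second vertex
-- g₂ ≠ g of G separates them: (g₂ , h) if g g₂ ∈ E(G), and (g₂ , h′) otherwise.
module Submission where

open import Defs
open import Data.Nat using (_≤_; s≤s)
open import Data.Fin using (Fin; zero; _≟_)
open import Data.Fin.Properties using (punchInᵢ≢i)
open import Data.Product using (_×_; _,_; ∃; swap)
open import Data.Sum using (inj₁; inj₂)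
open import Data.Empty using (⊥; ⊥-elim)
open import Function.Base using (_∘_)
open import Function.Bundles using (module Equivalence; mk⇔)
open import Relation.Nullary using (¬_; yes; no)
open import Relation.Binary.PropositionalEquality using (_≡_; _≢_; refl)
  renaming (sym to ≡-sym)

open Equivalence using (to; from)

∃-≢ : ∀ {n} → 2 ≤ n → (i : Fin n) → ∃ λ j → j ≢ i
∃-≢ (s≤s (s≤s _)) i = _ , punchInᵢ≢i i zero

module _ (G H : Graph) where

  ModAdj-irrefl : ∀ x → ¬ ModAdj G H x x
  ModAdj-irrefl _ (inj₁ (_ , b))                 = irrefl H b
  ModAdj-irrefl _ (inj₂ (inj₁ (a , _)))          = irrefl G a
  ModAdj-irrefl _ (inj₂ (inj₂ (inj₁ (a , _))))   = irrefl G a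
  ModAdj-irrefl _ (inj₂ (inj₂ (inj₂ (g≢g , _)))) = g≢g refl

  ModAdj-swap : ∀ {x y} → ModAdj G H x y → ModAdj H G (swap x) (swap y)
  ModAdj-swap (inj₁ (e , b))                         = inj₂ (inj₁ (b , e))
  ModAdj-swap (inj₂ (inj₁ (a , e)))                  = inj₁ (e , a)
  ModAdj-swap (inj₂ (inj₂ (inj₁ (a , b))))           = inj₂ (inj₂ (inj₁ (b , a)))
  ModAdj-swap (inj₂ (inj₂ (inj₂ (p , q , ¬a , ¬b)))) = inj₂ (inj₂ (inj₂ (q , p , ¬b , ¬a)))

  ModAdj-≡ˡ⇒Adj : ∀ {g h h′} → ModAdj G H (g , h) (g , h′) → Adj H h h′
  ModAdj-≡ˡ⇒Adj (inj₁ (_ , b))                 = b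
  ModAdj-≡ˡ⇒Adj (inj₂ (inj₁ (a , _)))          = ⊥-elim (irrefl G a)
  ModAdj-≡ˡ⇒Adj (inj₂ (inj₂ (inj₁ (_ , b))))   = b
  ModAdj-≡ˡ⇒Adj (inj₂ (inj₂ (inj₂ (g≢g , _)))) = ⊥-elim (g≢g refl)

  ModAdj-Adj⇒Adj : ∀ {g g′ h h′} → h ≢ h′ →
    ModAdj G H (g , h) (g′ , h′) → Adj G g g′ → Adj H h h′
  ModAdj-Adj⇒Adj _   (inj₁ (_ , b))                       _ = b
  ModAdj-Adj⇒Adj h≢h (inj₂ (inj₁ (_ , h≡h)))              _ = ⊥-elim (h≢h h≡h)
  ModAdj-Adj⇒Adj _   (inj₂ (inj₂ (inj₁ (_ , b))))         _ = b
  ModAdj-Adj⇒Adj _   (inj₂ (inj₂ (inj₂ (_ , _ , ¬a , _)))) a = ⊥-elim (¬a a)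

  twins⇒¬ModAdj : ∀ {x y} → SameNeighbourhood G H x y → ¬ ModAdj G H x y
  twins⇒¬ModAdj {y = y} same xy = ModAdj-irrefl y (to (same y) xy)

  twins-Adj⇒Adj : ∀ {g g′ h h′} → SameNeighbourhood G H (g , h) (g′ , h′) →
    Adj G g g′ → Adj H h h′
  twins-Adj⇒Adj same a = sym H (ModAdj-≡ˡ⇒Adj (to (same _) (inj₂ (inj₁ (a , refl)))))

module _ (G H : Graph) where

  ModAdj-≡ʳ⇒Adj : ∀ {g g′ h} → ModAdj G H (g , h) (g′ , h) → Adj G g g′
  ModAdj-≡ʳ⇒Adj = ModAdj-≡ˡ⇒Adj H G ∘ ModAdj-swap G H

  twins-swap : ∀ {x y} → SameNeighbourhood G H x y →
    SameNeighbourhood H G (swap x) (swap y)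
  twins-swap same z = mk⇔
    (ModAdj-swap G H ∘ to   (same (swap z)) ∘ ModAdj-swap H G)
    (ModAdj-swap G H ∘ from (same (swap z)) ∘ ModAdj-swap H G)

module _ (G H : Graph) where

  twins-≢-≢-absurd : ∀ {g g′ h h′} → g ≢ g′ → h ≢ h′ →
    ¬ SameNeighbourhood G H (g , h) (g′ , h′)
  twins-≢-≢-absurd {g} {g′} {h} {h′} g≢g′ h≢h′ same with adj? G g g′
  ... | yes a = twins⇒¬ModAdj G H same (inj₂ (inj₂ (inj₁ (a , twins-Adj⇒Adj G H same a))))
  ... | no ¬a = twins⇒¬ModAdj G H same (inj₂ (inj₂ (inj₂ (g≢g′ , h≢h′ , ¬a , ¬a ∘ b⇒a))))
    where
    b⇒a : Adj H h h′ → Adj G g g′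
    b⇒a = twins-Adj⇒Adj H G (twins-swap G H same)

  twins-≡-≢-absurd : 2 ≤ order G → ∀ {g h h′} → h ≢ h′ →
    ¬ SameNeighbourhood G H (g , h) (g , h′)
  twins-≡-≢-absurd 2≤|G| {g} {h} {h′} h≢h′ same = separate (∃-≢ 2≤|G| g)
    where
    ¬b : ¬ Adj H h h′
    ¬b b = twins⇒¬ModAdj G H same (inj₁ (refl , b))

    separate : (∃ λ g₂ → g₂ ≢ g) → ⊥
    separate (g₂ , g₂≢g) with adj? G g g₂
    ... | yes a = ¬b (sym H (ModAdj-Adj⇒Adj G H (h≢h′ ∘ ≡-sym) (to (same _) x~⟨g₂,h⟩) a))
      where
      x~⟨g₂,h⟩ : ModAdj G H (g , h) (g₂ , h)
      x~⟨g₂,h⟩ = inj₂ (inj₁ (a , refl))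
    ... | no ¬a = ¬a (ModAdj-≡ʳ⇒Adj G H (to (same _) x~⟨g₂,h′⟩))
      where
      x~⟨g₂,h′⟩ : ModAdj G H (g , h) (g₂ , h′)
      x~⟨g₂,h′⟩ = inj₂ (inj₂ (inj₂ (g₂≢g ∘ ≡-sym , h≢h′ , ¬a , ¬b)))

proposition2p2 : (G H : Graph) → 2 ≤ order G → 2 ≤ order H →
    (x y : V G × V H) → SameNeighbourhood G H x y → x ≡ y
proposition2p2 G H 2≤|G| 2≤|H| (g , h) (g′ , h′) same with g ≟ g′ | h ≟ h′
... | yes refl | yes refl = refl
... | yes refl | no h≢h′  = ⊥-elim (twins-≡-≢-absurd G H 2≤|G| h≢h′ same)
... | no g≢g′  | yes refl = ⊥-elim (twins-≡-≢-absurd H G 2≤|H| g≢g′ (twins-swap G H same))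
... | no g≢g′  | no h≢h′  = ⊥-elim (twins-≢-≢-absurd G H g≢g′ h≢h′ same)
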